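{- Let $k\ge 2$ be an even integer, let $b$ be an indeterminate, and let $A$ be the $k\times k$ matrix with entries $A_{ij}=\delta_{ij}-b\cdot[\,i+j>k\,]$ for $1\le i,j\le k$ (where $[\,\cdot\,]$ is $1$ if the condition holds and $0$ otherwise). Then $$\det A=\sum_{i=0}^{k}(-1)^{\lfloor\frac{i+1}{2}\rfloor}\binom{\lfloor\frac{k-i}{2}\rfloor+i}{i}b^i.$$
   Context: $\delta_{ij}$ is the Kronecker delta. Thus row $i$ of $A$ has $1$ on the diagonal position when $2i\le k$, $1-b$ on the diagonal when $2i>k$, $-b$ in the off-diagonal positions $j$ with $j>k-i$, and $0$ elsewhere. -}

module Defs where

open import Level using (Level)
open import Algebra.Bundles using (CommutativeRing)
open import Data.Nat using (ℕ; zero; suc; _<?_) renaming (_+_ to _+ℕ_)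
open import Data.Fin using (Fin; zero; suc; toℕ; punchIn; _≟_)
open import Relation.Nullary using (yes; no)

module _ {c ℓ : Level} (R : CommutativeRing c ℓ) where
  open CommutativeRing R using (Carrier; 0#; 1#; _+_; _*_; -_)

  negOnePow : ℕ → Carrier
  negOnePow zero    = 1#
  negOnePow (suc n) = - negOnePow n

  pow : Carrier → ℕ → Carrier
  pow x zero    = 1#
  pow x (suc n) = x * pow x n

  natR : ℕ → Carrier
  natR zero    = 0#
  natR (suc n) = 1# + natR n

  sumFin : (n : ℕ) → (Fin n → Carrier) → Carrier
  sumFin zero    f = 0#
  sumFin (suc n) f = f zero + sumFin n (λ i → f (suc i))

  sumℕ : ℕ → (ℕ → Carrier) → Carrier
  sumℕ zero    f = 0#
  sumℕ (suc n) f = f zero + sumℕ n (λ i → f (suc i))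

  det : (n : ℕ) → (Fin n → Fin n → Carrier) → Carrier
  det zero    M = 1#
  det (suc n) M =
    sumFin (suc n) (λ j → negOnePow (toℕ j) * (M zero j *
      det n (λ r s → M (suc r) (punchIn j s))))

  -- the k×k matrix A with A_{ij} = δ_{ij} - b·[i+j>k], indices 1-based
  -- (the Fin index i corresponds to the paper's index toℕ i + 1)
  matA : (k : ℕ) → Carrier → Fin k → Fin k → Carrier
  matA k b i j = δ + - ind
    where
    δ : Carrier
    δ with i ≟ j
    ... | yes _ = 1#
    ... | no  _ = 0#
    ind : Carrier
    ind with k <? (suc (toℕ i) +ℕ suc (toℕ j))
    ... | yes _ = b
    ... | no  _ = 0#

-- Let D k = det A for the k × k matrix A, and D⁺ k the determinant of the (k + 1) × (k + 1)
-- matrix whose region of -b starts one antidiagonal earlier. Expanding along the first row gives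
-- D (m + 2) = D⁺ m - b² D m, and one column and one row operation reduce D⁺ (p + 2) to
-- 2 D (p + 2) - D p, so D (p + 4) = (2 - b²) D (p + 2) - D p. By Pascal's rule the right-hand
-- side satisfies the same recurrence: its sign pattern (-1)^⌊(i+1)/2⌋ and the companion pattern
-- (-1)^⌊i/2⌋ turn into each other under the index shift. Both sides are 1 for k = 0 and
-- 1 - b - b² for k = 2. As det is the expansion along the first row, each row or column
-- operation is proved by induction on the size, passing to the minors of the first row.

{-# OPTIONS --safe #-}
module Submission where

open import Defs
open import Level using (Level)
open import Algebra.Bundles using (CommutativeRing)
open import Data.Nat.Combinatorics using (_C_; nCn≡1; nCk+nC[k+1]≡[n+1]C[k+1])
open import Data.Nat.Base as ℕ using (ℕ; zero; suc; z≤n; s≤s; z<s; s<s; _≤_; _<_; _⊓_; ⌊_/2⌋; _∸_)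
import Data.Nat.Properties as ℕ
open import Data.Integer.Base as ℤ using (ℤ; +_; -[1+_]; _⊖_; _◃_; ∣_∣; sign)
import Data.Integer.Properties as ℤ
open import Data.Fin.Base using (Fin; zero; suc; toℕ; punchIn)
import Data.Fin.Properties as Fin
open import Data.Sign.Base as Sign using (Sign)
open import Data.Maybe.Base using (Maybe; just; nothing)
open import Data.Sum.Base using (inj₁; inj₂)
open import Relation.Binary.PropositionalEquality as ≡ using (_≡_; _≢_; cong; cong₂)
open import Relation.Nullary using (yes; no; ¬_)
open import Data.Empty using (⊥-elim)
open import Function.Base using (_∘_)
import Algebra.Solver.Ring
import Algebra.Properties.Ring
import Algebra.Properties.AbelianGroup
import Algebra.Properties.Group
import Algebra.Properties.CommutativeSemigroup
import Algebra.Properties.Semiring.Mult.TCOptimised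
open import Algebra.Solver.Ring.AlmostCommutativeRing
  using (fromCommutativeRing; _-Raw-AlmostCommutative⟶_)
import Relation.Binary.Reasoning.Setoid as SetoidReasoning

-- The ring solver needs coefficients whose equality can be decided: ℤ, mapped into R. The
-- optimised multiple _×_ satisfies 1 × x = x, so that :0 and :1 denote 0# and 1# on the nose.
module IntegerCoefficients {c ℓ : Level} (R : CommutativeRing c ℓ) where
  open CommutativeRing R hiding (zero)
  open SetoidReasoning setoid
  open Algebra.Properties.Ring ring using (-1*x≈-x)
  open Algebra.Properties.AbelianGroup +-abelianGroup using (⁻¹-∙-comm)
  open Algebra.Properties.Group +-group using (ε⁻¹≈ε; ⁻¹-involutive)
  open Algebra.Properties.Semiring.Mult.TCOptimised semiring using (_×_; 1+×; ×-homo-+; ×1-homo-*)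
  open Algebra.Properties.CommutativeSemigroup *-commutativeSemigroup using (interchange)
  open Algebra.Properties.CommutativeSemigroup +-commutativeSemigroup
    using () renaming (interchange to +-interchange)

  ⟦_⟧ℤ : ℤ → Carrier
  ⟦ + n      ⟧ℤ = n × 1#
  ⟦ -[1+ n ] ⟧ℤ = - (suc n × 1#)

  ⟦⊖⟧ : ∀ m n → ⟦ m ⊖ n ⟧ℤ ≈ m × 1# + - (n × 1#)
  ⟦⊖⟧ m       zero    = sym (trans (+-congˡ ε⁻¹≈ε) (+-identityʳ _))
  ⟦⊖⟧ zero    (suc n) = sym (+-identityˡ _)
  ⟦⊖⟧ (suc m) (suc n) = begin
    ⟦ suc m ⊖ suc n ⟧ℤ                  ≡⟨ cong ⟦_⟧ℤ (ℤ.[1+m]⊖[1+n]≡m⊖n m n) ⟩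
    ⟦ m ⊖ n ⟧ℤ                          ≈⟨ ⟦⊖⟧ m n ⟩
    m × 1# + - (n × 1#)                 ≈⟨ cancel 1# (m × 1#) (- (n × 1#)) ⟨
    (1# + m × 1#) + (- 1# + - (n × 1#)) ≈⟨ +-cong (1+× m 1#) (sym (⁻¹-∙-comm 1# (n × 1#))) ⟨
    suc m × 1# + - (1# + n × 1#)        ≈⟨ +-congˡ (-‿cong (1+× n 1#)) ⟨
    suc m × 1# + - (suc n × 1#)         ∎
    where
    cancel : ∀ o x y → (o + x) + (- o + y) ≈ x + y
    cancel o x y = trans (+-interchange o x (- o) y) (trans (+-congʳ (-‿inverseʳ o)) (+-identityˡ _))

  ⟦+⟧ : ∀ i j → ⟦ i ℤ.+ j ⟧ℤ ≈ ⟦ i ⟧ℤ + ⟦ j ⟧ℤ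
  ⟦+⟧ (+ m)    (+ n)    = ×-homo-+ 1# m n
  ⟦+⟧ (+ m)    -[1+ n ] = ⟦⊖⟧ m (suc n)
  ⟦+⟧ -[1+ m ] (+ n)    = trans (⟦⊖⟧ n (suc m)) (+-comm _ _)
  ⟦+⟧ -[1+ m ] -[1+ n ] = begin
    - (suc (suc (m ℕ.+ n)) × 1#)         ≡⟨ cong (λ k → - (suc k × 1#)) (ℕ.+-suc m n) ⟨
    - ((suc m ℕ.+ suc n) × 1#)           ≈⟨ -‿cong (×-homo-+ 1# (suc m) (suc n)) ⟩
    - (suc m × 1# + suc n × 1#)          ≈⟨ ⁻¹-∙-comm _ _ ⟨
    - (suc m × 1#) + - (suc n × 1#)      ∎

  ⟦-⟧ : ∀ i → ⟦ ℤ.- i ⟧ℤ ≈ - ⟦ i ⟧ℤ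
  ⟦-⟧ (+ zero)  = sym ε⁻¹≈ε
  ⟦-⟧ (+ suc n) = refl
  ⟦-⟧ -[1+ n ]  = sym (⁻¹-involutive _)

  signR : Sign → Carrier
  signR Sign.+ = 1#
  signR Sign.- = - 1#

  signR-* : ∀ s t → signR (s Sign.* t) ≈ signR s * signR t
  signR-* Sign.+ t      = sym (*-identityˡ _)
  signR-* Sign.- Sign.+ = sym (*-identityʳ _)
  signR-* Sign.- Sign.- = sym (trans (-1*x≈-x _) (⁻¹-involutive _))

  ⟦◃⟧ : ∀ s n → ⟦ s ◃ n ⟧ℤ ≈ signR s * (n × 1#)
  ⟦◃⟧ s      zero    = sym (zeroʳ _)
  ⟦◃⟧ Sign.+ (suc n) = sym (*-identityˡ _)
  ⟦◃⟧ Sign.- (suc n) = sym (-1*x≈-x _)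

  ⟦⟧-sign-abs : ∀ i → ⟦ i ⟧ℤ ≈ signR (sign i) * (∣ i ∣ × 1#)
  ⟦⟧-sign-abs i = trans (reflexive (cong ⟦_⟧ℤ (≡.sym (ℤ.◃-inverse i)))) (⟦◃⟧ (sign i) ∣ i ∣)

  ⟦*⟧ : ∀ i j → ⟦ i ℤ.* j ⟧ℤ ≈ ⟦ i ⟧ℤ * ⟦ j ⟧ℤ
  ⟦*⟧ i j = begin
    ⟦ i ℤ.* j ⟧ℤ
      ≈⟨ ⟦◃⟧ (sign i Sign.* sign j) (∣ i ∣ ℕ.* ∣ j ∣) ⟩
    signR (sign i Sign.* sign j) * ((∣ i ∣ ℕ.* ∣ j ∣) × 1#)
      ≈⟨ *-cong (signR-* (sign i) (sign j)) (×1-homo-* ∣ i ∣ ∣ j ∣) ⟩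
    (signR (sign i) * signR (sign j)) * ((∣ i ∣ × 1#) * (∣ j ∣ × 1#))
      ≈⟨ interchange _ _ _ _ ⟩
    (signR (sign i) * (∣ i ∣ × 1#)) * (signR (sign j) * (∣ j ∣ × 1#))
      ≈⟨ *-cong (⟦⟧-sign-abs i) (⟦⟧-sign-abs j) ⟨
    ⟦ i ⟧ℤ * ⟦ j ⟧ℤ
      ∎

  ℤ⟶R : ℤ.+-*-rawRing -Raw-AlmostCommutative⟶ fromCommutativeRing R
  ℤ⟶R = record
    { ⟦_⟧    = ⟦_⟧ℤ
    ; +-homo = ⟦+⟧
    ; *-homo = ⟦*⟧
    ; -‿homo = ⟦-⟧
    ; 0-homo = refl
    ; 1-homo = refl
    }

  _≟ℤ_ : ∀ i j → Maybe (⟦ i ⟧ℤ ≈ ⟦ j ⟧ℤ)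
  i ≟ℤ j with i ℤ.≟ j
  ... | yes i≡j = just (reflexive (cong ⟦_⟧ℤ i≡j))
  ... | no _    = nothing

  open Algebra.Solver.Ring ℤ.+-*-rawRing (fromCommutativeRing R) ℤ⟶R _≟ℤ_ public
    using (Polynomial; solve; _:+_; _:*_; :-_; _:=_; con)

  :0 :1 : ∀ {n} → Polynomial n
  :0 = con (+ 0)
  :1 = con (+ 1)

module Sums {c ℓ : Level} (R : CommutativeRing c ℓ) where
  open CommutativeRing R hiding (zero)
  open SetoidReasoning setoid
  open Algebra.Properties.CommutativeSemigroup +-commutativeSemigroup using (interchange)

  sumFin-cong : ∀ n {f g : Fin n → Carrier} → (∀ i → f i ≈ g i) → sumFin R n f ≈ sumFin R n g
  sumFin-cong zero    f≈g = refl
  sumFin-cong (suc n) f≈g = +-cong (f≈g zero) (sumFin-cong n (λ i → f≈g (suc i)))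

  sumFin-toℕ : ∀ n (f : ℕ → Carrier) → sumFin R n (λ i → f (toℕ i)) ≈ sumℕ R n f
  sumFin-toℕ zero    f = refl
  sumFin-toℕ (suc n) f = +-congˡ (sumFin-toℕ n (λ i → f (suc i)))

  sumℕ-cong : ∀ n {f g : ℕ → Carrier} → (∀ i → i < n → f i ≈ g i) → sumℕ R n f ≈ sumℕ R n g
  sumℕ-cong zero    f≈g = refl
  sumℕ-cong (suc n) f≈g = +-cong (f≈g 0 z<s) (sumℕ-cong n (λ i i<n → f≈g (suc i) (s<s i<n)))

  sumℕ-zero : ∀ n {f : ℕ → Carrier} → (∀ i → i < n → f i ≈ 0#) → sumℕ R n f ≈ 0#
  sumℕ-zero zero    f≈0 = refl
  sumℕ-zero (suc n) f≈0 =
    trans (+-cong (f≈0 0 z<s) (sumℕ-zero n (λ i i<n → f≈0 (suc i) (s<s i<n)))) (+-identityˡ 0#)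

  sumℕ-last : ∀ n (f : ℕ → Carrier) → sumℕ R (suc n) f ≈ sumℕ R n f + f n
  sumℕ-last zero    f = trans (+-identityʳ (f 0)) (sym (+-identityˡ (f 0)))
  sumℕ-last (suc n) f = trans (+-congˡ (sumℕ-last n (λ i → f (suc i)))) (sym (+-assoc _ _ _))

  sumℕ-last₂ : ∀ n (f : ℕ → Carrier) → sumℕ R (suc (suc n)) f ≈ (sumℕ R n f + f n) + f (suc n)
  sumℕ-last₂ n f = trans (sumℕ-last (suc n) f) (+-congʳ (sumℕ-last n f))

  sumℕ-+ : ∀ n (f g : ℕ → Carrier) → sumℕ R n (λ i → f i + g i) ≈ sumℕ R n f + sumℕ R n g
  sumℕ-+ zero    f g = sym (+-identityˡ 0#)
  sumℕ-+ (suc n) f g =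
    trans (+-congˡ (sumℕ-+ n (λ i → f (suc i)) (λ i → g (suc i)))) (interchange _ _ _ _)

  sumℕ-*ˡ : ∀ n (x : Carrier) (f : ℕ → Carrier) → sumℕ R n (λ i → x * f i) ≈ x * sumℕ R n f
  sumℕ-*ˡ zero    x f = sym (zeroʳ x)
  sumℕ-*ˡ (suc n) x f = trans (+-congˡ (sumℕ-*ˡ n x (λ i → f (suc i)))) (sym (distribˡ x _ _))

module Determinant {c ℓ : Level} (R : CommutativeRing c ℓ) where
  open CommutativeRing R hiding (zero)
  open SetoidReasoning setoid
  open IntegerCoefficients R
  open Sums R

  det-cong : ∀ n {M N : Fin n → Fin n → Carrier} → (∀ i j → M i j ≈ N i j) → det R n M ≈ det R n N
  det-cong zero    M≈N = refl
  det-cong (suc n) {M} {N} M≈N = sumFin-cong (suc n) {cofactorTerm M} {cofactorTerm N} λ j →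
    *-congˡ (*-cong (M≈N zero j) (det-cong n (λ r s → M≈N (suc r) (punchIn j s))))
    where
    cofactorTerm : (Fin (suc n) → Fin (suc n) → Carrier) → Fin (suc n) → Carrier
    cofactorTerm P j = negOnePow R (toℕ j) * (P zero j * det R n (λ r s → P (suc r) (punchIn j s)))

  Matrix : Set c
  Matrix = ℕ → ℕ → Carrier

  detℕ : ℕ → Matrix → Carrier
  detℕ n f = det R n (λ i j → f (toℕ i) (toℕ j))

  Agree : ℕ → ℕ → Matrix → Matrix → Set ℓ
  Agree m n f g = ∀ i j → i < m → j < n → f i j ≈ g i j

  Agree-sym : ∀ {m n f g} → Agree m n f g → Agree m n g f
  Agree-sym f≈g i j i<m j<n = sym (f≈g i j i<m j<n)

  detℕ-cong : ∀ n {f g} → Agree n n f g → detℕ n f ≈ detℕ n g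
  detℕ-cong n f≈g = det-cong n (λ i j → f≈g (toℕ i) (toℕ j) (Fin.toℕ<n i) (Fin.toℕ<n j))

  punchInℕ : ℕ → ℕ → ℕ
  punchInℕ zero    s       = suc s
  punchInℕ (suc j) zero    = zero
  punchInℕ (suc j) (suc s) = suc (punchInℕ j s)

  toℕ-punchIn : ∀ {n} (j : Fin (suc n)) (s : Fin n) → toℕ (punchIn j s) ≡ punchInℕ (toℕ j) (toℕ s)
  toℕ-punchIn zero    s       = ≡.refl
  toℕ-punchIn (suc j) zero    = ≡.refl
  toℕ-punchIn (suc j) (suc s) = cong suc (toℕ-punchIn j s)

  punchInℕ-< : ∀ {j s} → s < j → punchInℕ j s ≡ s
  punchInℕ-< {suc j} {zero}  _         = ≡.refl
  punchInℕ-< {suc j} {suc s} (s<s s<j) = cong suc (punchInℕ-< s<j)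

  punchInℕ-≥ : ∀ {j s} → j ≤ s → punchInℕ j s ≡ suc s
  punchInℕ-≥ {zero}  {s}     _         = ≡.refl
  punchInℕ-≥ {suc j} {suc s} (s≤s j≤s) = cong suc (punchInℕ-≥ j≤s)

  punchInℕ-≤ : ∀ j s → punchInℕ j s ≤ suc s
  punchInℕ-≤ zero    s       = ℕ.≤-refl
  punchInℕ-≤ (suc j) zero    = z≤n
  punchInℕ-≤ (suc j) (suc s) = s≤s (punchInℕ-≤ j s)

  punchInℕ-<-suc : ∀ j {s n} → s < n → punchInℕ j s < suc n
  punchInℕ-<-suc j {s} s<n = s≤s (ℕ.≤-trans (punchInℕ-≤ j s) s<n)

  minor : ℕ → Matrix → Matrix
  minor j f r s = f (suc r) (punchInℕ j s)

  minor-agree : ∀ {m n f g} j → Agree (suc m) (suc n) f g → Agree m n (minor j f) (minor j g)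
  minor-agree j f≈g r s r<m s<n = f≈g (suc r) (punchInℕ j s) (s<s r<m) (punchInℕ-<-suc j s<n)

  minor-last-agree : ∀ {n f g} → Agree (suc n) n f g → Agree n n (minor n f) (minor n g)
  minor-last-agree {f = f} {g} f≈g r s r<n s<n =
    ≡.subst (λ c → f (suc r) c ≈ g (suc r) c) (≡.sym (punchInℕ-< s<n)) (f≈g (suc r) s (s<s r<n) s<n)

  minor-below : ∀ {j s} f r → s < j → minor j f r s ≡ f (suc r) s
  minor-below f r s<j = cong (f (suc r)) (punchInℕ-< s<j)

  minor-above : ∀ {j s} f r → j ≤ s → minor j f r s ≡ f (suc r) (suc s)
  minor-above f r j≤s = cong (f (suc r)) (punchInℕ-≥ j≤s)

  laplaceTerm : ℕ → Matrix → ℕ → Carrier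
  laplaceTerm n f j = negOnePow R j * (f 0 j * detℕ n (minor j f))

  laplace : ∀ n f → detℕ (suc n) f ≈ sumℕ R (suc n) (laplaceTerm n f)
  laplace n f = trans
    (sumFin-cong (suc n) {g = λ j → laplaceTerm n f (toℕ j)} λ j →
      *-congˡ (*-congˡ (det-cong n λ r s → reflexive (cong (f (suc (toℕ r))) (toℕ-punchIn j s)))))
    (sumFin-toℕ (suc n) (laplaceTerm n f))

  det₁ : ∀ f → detℕ 1 f ≈ f 0 0
  det₁ f = solve 1 (λ a → :1 :* (a :* :1) :+ :0 := a) refl (f 0 0)

  det₂ : ∀ f → detℕ 2 f ≈ f 0 0 * f 1 1 + - (f 0 1 * f 1 0)
  det₂ f = solve 4 (λ a b c d →
      :1 :* (a :* (:1 :* (d :* :1) :+ :0))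
        :+ ((:- :1) :* (b :* (:1 :* (c :* :1) :+ :0)) :+ :0)
      := a :* d :+ (:- (b :* c)))
    refl (f 0 0) (f 0 1) (f 1 0) (f 1 1)

  laplace-cong : ∀ n {f g} → (∀ j → j < suc n → laplaceTerm n f j ≈ laplaceTerm n g j) →
    detℕ (suc n) f ≈ detℕ (suc n) g
  laplace-cong n {f} {g} f≈g = begin
    detℕ (suc n) f                   ≈⟨ laplace n f ⟩
    sumℕ R (suc n) (laplaceTerm n f) ≈⟨ sumℕ-cong (suc n) f≈g ⟩
    sumℕ R (suc n) (laplaceTerm n g) ≈⟨ laplace n g ⟨
    detℕ (suc n) g                   ∎

  laplace-linear : ∀ n {f g h x y} →
    (∀ j → j < suc n → laplaceTerm n h j ≈ x * laplaceTerm n f j + y * laplaceTerm n g j) →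
    detℕ (suc n) h ≈ x * detℕ (suc n) f + y * detℕ (suc n) g
  laplace-linear n {f} {g} {h} {x} {y} h-lin = begin
    detℕ (suc n) h
      ≈⟨ laplace n h ⟩
    sumℕ R (suc n) (laplaceTerm n h)
      ≈⟨ sumℕ-cong (suc n) h-lin ⟩
    sumℕ R (suc n) (λ j → x * laplaceTerm n f j + y * laplaceTerm n g j)
      ≈⟨ sumℕ-+ (suc n) (λ j → x * laplaceTerm n f j) (λ j → y * laplaceTerm n g j) ⟩
    sumℕ R (suc n) (λ j → x * laplaceTerm n f j) + sumℕ R (suc n) (λ j → y * laplaceTerm n g j)
      ≈⟨ +-cong (sumℕ-*ˡ (suc n) x (laplaceTerm n f)) (sumℕ-*ˡ (suc n) y (laplaceTerm n g)) ⟩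
    x * sumℕ R (suc n) (laplaceTerm n f) + y * sumℕ R (suc n) (laplaceTerm n g)
      ≈⟨ +-cong (*-congˡ (laplace n f)) (*-congˡ (laplace n g)) ⟨
    x * detℕ (suc n) f + y * detℕ (suc n) g
      ∎

  laplace-scale : ∀ m {f x} →
    (∀ j → j < suc m → laplaceTerm (suc m) f j ≈ x * laplaceTerm m f j) →
    laplaceTerm (suc m) f (suc m) ≈ 0# →
    detℕ (suc (suc m)) f ≈ x * detℕ (suc m) f
  laplace-scale m {f} {x} f-scale last≈0 = begin
    detℕ (suc (suc m)) f
      ≈⟨ laplace (suc m) f ⟩
    sumℕ R (suc (suc m)) (laplaceTerm (suc m) f)
      ≈⟨ sumℕ-last (suc m) (laplaceTerm (suc m) f) ⟩
    sumℕ R (suc m) (laplaceTerm (suc m) f) + laplaceTerm (suc m) f (suc m)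
      ≈⟨ +-cong (sumℕ-cong (suc m) f-scale) last≈0 ⟩
    sumℕ R (suc m) (λ j → x * laplaceTerm m f j) + 0#
      ≈⟨ +-identityʳ _ ⟩
    sumℕ R (suc m) (λ j → x * laplaceTerm m f j)
      ≈⟨ sumℕ-*ˡ (suc m) x (laplaceTerm m f) ⟩
    x * sumℕ R (suc m) (laplaceTerm m f)
      ≈⟨ *-congˡ (laplace m f) ⟨
    x * detℕ (suc m) f
      ∎

  term-linear-minor : ∀ s a x y d e → s * (a * (x * d + y * e)) ≈ x * (s * (a * d)) + y * (s * (a * e))
  term-linear-minor = solve 6 (λ s a x y d e →
    s :* (a :* (x :* d :+ y :* e)) := x :* (s :* (a :* d)) :+ y :* (s :* (a :* e))) refl

  term-linear-entry : ∀ s x y a e d → s * ((x * a + y * e) * d) ≈ x * (s * (a * d)) + y * (s * (e * d))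
  term-linear-entry = solve 6 (λ s x y a e d →
    s :* ((x :* a :+ y :* e) :* d) := x :* (s :* (a :* d)) :+ y :* (s :* (e :* d))) refl

  term-scale-minor : ∀ s a x d → s * (a * (x * d)) ≈ x * (s * (a * d))
  term-scale-minor = solve 4 (λ s a x d → s :* (a :* (x :* d)) := x :* (s :* (a :* d))) refl

  term-zero-entry : ∀ s {a} d → a ≈ 0# → s * (a * d) ≈ 0#
  term-zero-entry s d a≈0 = trans (*-congˡ (trans (*-congʳ a≈0) (zeroˡ d))) (zeroʳ s)

  term-zero-minor : ∀ s a {d} → d ≈ 0# → s * (a * d) ≈ 0#
  term-zero-minor s a d≈0 = trans (*-congˡ (trans (*-congˡ d≈0) (zeroʳ a))) (zeroʳ s)

  laplaceTerm-linear-minor : ∀ n j {f g h x y} → h 0 j ≈ f 0 j → g 0 j ≈ f 0 j →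
    detℕ n (minor j h) ≈ x * detℕ n (minor j f) + y * detℕ n (minor j g) →
    laplaceTerm n h j ≈ x * laplaceTerm n f j + y * laplaceTerm n g j
  laplaceTerm-linear-minor n j {x = x} {y} h≈f g≈f minor-lin =
    trans (*-congˡ (*-cong h≈f minor-lin))
      (trans (term-linear-minor _ _ x y _ _) (+-congˡ (*-congˡ (*-congˡ (*-congʳ (sym g≈f))))))

  laplaceTerm-linear-lastCol : ∀ n {f g h x y} → Agree (suc n) n h f → Agree (suc n) n g f →
    h 0 n ≈ x * f 0 n + y * g 0 n →
    laplaceTerm n h n ≈ x * laplaceTerm n f n + y * laplaceTerm n g n
  laplaceTerm-linear-lastCol n {f} {g} {h} {x} {y} h≈f g≈f h₀ₙ = begin
    negOnePow R n * (h 0 n * detℕ n (minor n h))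
      ≈⟨ *-congˡ (*-cong h₀ₙ (detℕ-cong n (minor-last-agree h≈f))) ⟩
    negOnePow R n * ((x * f 0 n + y * g 0 n) * detℕ n (minor n f))
      ≈⟨ term-linear-entry _ x y _ _ _ ⟩
    x * laplaceTerm n f n + y * (negOnePow R n * (g 0 n * detℕ n (minor n f)))
      ≈⟨ +-congˡ (*-congˡ (*-congˡ (*-congˡ (detℕ-cong n (minor-last-agree (Agree-sym g≈f)))))) ⟩
    x * laplaceTerm n f n + y * laplaceTerm n g n
      ∎

  det-linear-lastCol : ∀ n {f g h x y} → Agree (suc n) n h f → Agree (suc n) n g f →
    (∀ i → i < suc n → h i n ≈ x * f i n + y * g i n) →
    detℕ (suc n) h ≈ x * detℕ (suc n) f + y * detℕ (suc n) g
  det-linear-lastCol zero {f} {g} {h} h≈f g≈f hₙ = laplace-linear 0 {f} {g} {h} λ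
    { zero _ → laplaceTerm-linear-lastCol 0 {f} {g} {h} h≈f g≈f (hₙ 0 z<s) ; (suc _) (s<s ()) }
  det-linear-lastCol (suc m) {f} {g} {h} {x} {y} h≈f g≈f hₙ =
    laplace-linear (suc m) {f} {g} {h} term
    where
    term : ∀ j → j < suc (suc m) →
      laplaceTerm (suc m) h j ≈ x * laplaceTerm (suc m) f j + y * laplaceTerm (suc m) g j
    term j j≤1+m with ℕ.m<1+n⇒m<n∨m≡n j≤1+m
    ... | inj₂ ≡.refl  = laplaceTerm-linear-lastCol (suc m) {f} {g} {h} h≈f g≈f (hₙ 0 z<s)
    ... | inj₁ j<1+m = laplaceTerm-linear-minor (suc m) j {f} {g} {h}
      (h≈f 0 j z<s j<1+m) (g≈f 0 j z<s j<1+m)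
      (det-linear-lastCol m {minor j f} {minor j g} {minor j h}
        (minor-agree j h≈f) (minor-agree j g≈f) minor-lastCol)
      where
      minor-lastCol : ∀ r → r < suc m → minor j h r m ≈ x * minor j f r m + y * minor j g r m
      minor-lastCol r r<1+m = ≡.subst (λ c → h (suc r) c ≈ x * f (suc r) c + y * g (suc r) c)
        (≡.sym (punchInℕ-≥ (ℕ.≤-pred j<1+m))) (hₙ (suc r) (s<s r<1+m))

  det-linear-lastRow : ∀ n {f g h x y} → Agree n (suc n) h f → Agree n (suc n) g f →
    (∀ j → j < suc n → h n j ≈ x * f n j + y * g n j) →
    detℕ (suc n) h ≈ x * detℕ (suc n) f + y * detℕ (suc n) g
  det-linear-lastRow zero {f} {g} {h} {x} {y} _ _ hₙ = laplace-linear 0 {f} {g} {h} λ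
    { zero _ → trans (*-congˡ (*-congʳ (hₙ 0 z<s))) (term-linear-entry 1# x y (f 0 0) (g 0 0) 1#)
    ; (suc _) (s<s ()) }
  det-linear-lastRow (suc m) {f} {g} {h} h≈f g≈f hₙ =
    laplace-linear (suc m) {f} {g} {h} λ j j<2+m →
      laplaceTerm-linear-minor (suc m) j {f} {g} {h} (h≈f 0 j z<s j<2+m) (g≈f 0 j z<s j<2+m)
        (det-linear-lastRow m {minor j f} {minor j g} {minor j h}
          (minor-agree j h≈f) (minor-agree j g≈f)
          (λ s s<1+m → hₙ (punchInℕ j s) (punchInℕ-<-suc j s<1+m)))

  det-equalLastCols : ∀ n {f} → (∀ i → i < suc (suc n) → f i (suc n) ≈ f i n) →
    detℕ (suc (suc n)) f ≈ 0#
  equalLastCols-innerTerm : ∀ n {f} → (∀ i → i < suc (suc n) → f i (suc n) ≈ f i n) →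
    ∀ j → j < n → laplaceTerm (suc n) f j ≈ 0#

  det-equalLastCols n {f} f-eq = begin
    detℕ (suc (suc n)) f                       ≈⟨ laplace (suc n) f ⟩
    sumℕ R (suc (suc n)) t                     ≈⟨ sumℕ-last₂ n t ⟩
    (sumℕ R n t + t n) + t (suc n)             ≈⟨ +-assoc _ _ _ ⟩
    sumℕ R n t + (t n + t (suc n))             ≈⟨ +-cong (sumℕ-zero n inner) lastTwo ⟩
    0# + 0#                                    ≈⟨ +-identityʳ 0# ⟩
    0#                                         ∎
    where
    t = laplaceTerm (suc n) f
    inner = equalLastCols-innerTerm n {f} f-eq
    minors-agree : Agree (suc n) (suc n) (minor n f) (minor (suc n) f)
    minors-agree r s r<1+n s<1+n with ℕ.m<1+n⇒m<n∨m≡n s<1+n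
    ... | inj₁ s<n    = reflexive (≡.trans (minor-below f r s<n) (≡.sym (minor-below f r s<1+n)))
    ... | inj₂ ≡.refl = begin
      minor s f r s       ≡⟨ minor-above f r ℕ.≤-refl ⟩
      f (suc r) (suc s)   ≈⟨ f-eq (suc r) (s<s r<1+n) ⟩
      f (suc r) s         ≡⟨ minor-below f r s<1+n ⟨
      minor (suc s) f r s ∎
    lastTwo : t n + t (suc n) ≈ 0#
    lastTwo = begin
      negOnePow R n * (f 0 n * detℕ (suc n) (minor n f))
        + - negOnePow R n * (f 0 (suc n) * detℕ (suc n) (minor (suc n) f))
        ≈⟨ +-congˡ (*-congˡ (*-cong (f-eq 0 z<s) (detℕ-cong (suc n) (Agree-sym minors-agree)))) ⟩
      negOnePow R n * (f 0 n * detℕ (suc n) (minor n f))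
        + - negOnePow R n * (f 0 n * detℕ (suc n) (minor n f))
        ≈⟨ solve 3 (λ s a d → s :* (a :* d) :+ (:- s) :* (a :* d) := :0) refl _ _ _ ⟩
      0# ∎

  equalLastCols-innerTerm (suc m) {f} f-eq j j<1+m =
    term-zero-minor _ _ (det-equalLastCols m {minor j f} minor-eq)
    where
    minor-eq : ∀ r → r < suc (suc m) → minor j f r (suc m) ≈ minor j f r m
    minor-eq r r<2+m = begin
      minor j f r (suc m)       ≡⟨ minor-above f r (ℕ.<⇒≤ j<1+m) ⟩
      f (suc r) (suc (suc m))   ≈⟨ f-eq (suc r) (s<s r<2+m) ⟩
      f (suc r) (suc m)         ≡⟨ minor-above f r (ℕ.≤-pred j<1+m) ⟨
      minor j f r m             ∎

  det-addLastCol : ∀ n {f g x} → Agree (suc (suc n)) (suc n) g f →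
    (∀ i → i < suc (suc n) → g i (suc n) ≈ f i (suc n) + x * f i n) →
    detℕ (suc (suc n)) g ≈ detℕ (suc (suc n)) f
  det-addLastCol n {f} {g} {x} g≈f gₙ₊₁ = begin
    detℕ (suc (suc n)) g
      ≈⟨ det-linear-lastCol (suc n) {f} {f′} {g} g≈f f′≈f gₙ₊₁′ ⟩
    1# * detℕ (suc (suc n)) f + x * detℕ (suc (suc n)) f′
      ≈⟨ +-cong (*-identityˡ _) (*-congˡ (det-equalLastCols n {f′} f′-eq)) ⟩
    detℕ (suc (suc n)) f + x * 0#
      ≈⟨ trans (+-congˡ (zeroʳ x)) (+-identityʳ _) ⟩
    detℕ (suc (suc n)) f
      ∎
    where
    f′ : Matrix
    f′ i j = f i (j ⊓ n)
    f′≈f : Agree (suc (suc n)) (suc n) f′ f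
    f′≈f i j _ j<1+n = reflexive (cong (f i) (ℕ.m≤n⇒m⊓n≡m (ℕ.≤-pred j<1+n)))
    f′-eq : ∀ i → i < suc (suc n) → f′ i (suc n) ≈ f′ i n
    f′-eq i _ = reflexive (cong (f i) (≡.trans (ℕ.m≥n⇒m⊓n≡n (ℕ.n≤1+n n)) (≡.sym (ℕ.⊓-idem n))))
    gₙ₊₁′ : ∀ i → i < suc (suc n) → g i (suc n) ≈ 1# * f i (suc n) + x * f′ i (suc n)
    gₙ₊₁′ i i<2+n = trans (gₙ₊₁ i i<2+n)
      (+-cong (sym (*-identityˡ _)) (*-congˡ (reflexive (cong (f i) (≡.sym (ℕ.m≥n⇒m⊓n≡n (ℕ.n≤1+n n)))))))

  det-addRow : ∀ n {f g x} → Agree n (suc (suc n)) g f →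
    (∀ j → j < suc (suc n) → g n j ≈ f n j + x * f (suc n) j) →
    (∀ j → j < suc (suc n) → g (suc n) j ≈ f (suc n) j) →
    detℕ (suc (suc n)) g ≈ detℕ (suc (suc n)) f
  det-addRow zero {f} {g} {x} _ g₀ g₁ = begin
    detℕ 2 g                                       ≈⟨ det₂ g ⟩
    g 0 0 * g 1 1 + - (g 0 1 * g 1 0)
      ≈⟨ +-cong (*-cong (g₀ 0 z<s) (g₁ 1 (s<s z<s))) (-‿cong (*-cong (g₀ 1 (s<s z<s)) (g₁ 0 z<s))) ⟩
    (f 0 0 + x * f 1 0) * f 1 1 + - ((f 0 1 + x * f 1 1) * f 1 0)
      ≈⟨ solve 5 (λ a b c d x → (a :+ x :* c) :* d :+ (:- ((b :+ x :* d) :* c))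
                             := a :* d :+ (:- (b :* c)))
           refl (f 0 0) (f 0 1) (f 1 0) (f 1 1) x ⟩
    f 0 0 * f 1 1 + - (f 0 1 * f 1 0)              ≈⟨ det₂ f ⟨
    detℕ 2 f                                       ∎
  det-addRow (suc m) {f} {g} g≈f gₙ gₙ₊₁ = laplace-cong (suc (suc m)) {g} {f} λ j j<3+m →
    *-congˡ (*-cong (g≈f 0 j z<s j<3+m)
      (det-addRow m {minor j f} {minor j g} (minor-agree j g≈f)
        (λ s s<2+m → gₙ (punchInℕ j s) (punchInℕ-<-suc j s<2+m))
        (λ s s<2+m → gₙ₊₁ (punchInℕ j s) (punchInℕ-<-suc j s<2+m))))

  det-lastCol-unit : ∀ n {f x} → (∀ i → i < n → f i n ≈ 0#) → f n n ≈ x →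
    detℕ (suc n) f ≈ x * detℕ n f
  det-lastCol-unit zero    {f} {x} _ f₀₀ = trans (det₁ f) (trans f₀₀ (sym (*-identityʳ x)))
  det-lastCol-unit (suc m) {f} {x} above fₙₙ =
    laplace-scale m {f} inner (term-zero-entry _ _ (above 0 z<s))
    where
    inner : ∀ j → j < suc m → laplaceTerm (suc m) f j ≈ x * laplaceTerm m f j
    inner j j<1+m = trans (*-congˡ (*-congˡ (det-lastCol-unit m {minor j f} above′ fₘₘ′)))
                          (term-scale-minor _ _ x _)
      where
      j≤m = ℕ.≤-pred j<1+m
      above′ : ∀ i → i < m → minor j f i m ≈ 0#
      above′ i i<m = trans (reflexive (minor-above f i j≤m)) (above (suc i) (s<s i<m))
      fₘₘ′ : minor j f m m ≈ x
      fₘₘ′ = trans (reflexive (minor-above f m j≤m)) fₙₙ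

  det-lastRow-unit : ∀ n {f x} → (∀ j → j < n → f n j ≈ 0#) → f n n ≈ x →
    detℕ (suc n) f ≈ x * detℕ n f
  det-lastRow-unit zero    {f} {x} _ f₀₀ = trans (det₁ f) (trans f₀₀ (sym (*-identityʳ x)))
  det-lastRow-unit (suc m) {f} {x} left fₙₙ = laplace-scale m {f} inner last
    where
    inner : ∀ j → j < suc m → laplaceTerm (suc m) f j ≈ x * laplaceTerm m f j
    inner j j<1+m = trans (*-congˡ (*-congˡ (det-lastRow-unit m {minor j f} left′ fₘₘ′)))
                          (term-scale-minor _ _ x _)
      where
      left′ : ∀ s → s < m → minor j f m s ≈ 0#
      left′ s s<m = left (punchInℕ j s) (s≤s (ℕ.≤-trans (punchInℕ-≤ j s) s<m))
      fₘₘ′ : minor j f m m ≈ x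
      fₘₘ′ = trans (reflexive (minor-above f m (ℕ.≤-pred j<1+m))) fₙₙ
    last : laplaceTerm (suc m) f (suc m) ≈ 0#
    last = term-zero-minor _ _ (trans
      (det-lastRow-unit m {minor (suc m) f}
        (λ s s<m → trans (reflexive (minor-below f m (ℕ.m<n⇒m<1+n s<m))) (left s (ℕ.m<n⇒m<1+n s<m)))
        (trans (reflexive (minor-below f m (ℕ.n<1+n m))) (left m (ℕ.n<1+n m))))
      (zeroˡ _))

  det-firstRow-unit : ∀ n {f} → (∀ j → j < n → f 0 (suc j) ≈ 0#) →
    detℕ (suc n) f ≈ f 0 0 * detℕ n (λ r s → f (suc r) (suc s))
  det-firstRow-unit n {f} right = begin
    detℕ (suc n) f
      ≈⟨ laplace n f ⟩
    laplaceTerm n f 0 + sumℕ R n (λ j → laplaceTerm n f (suc j))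
      ≈⟨ +-congˡ (sumℕ-zero n (λ j j<n → term-zero-entry _ _ (right j j<n))) ⟩
    1# * (f 0 0 * detℕ n (λ r s → f (suc r) (suc s))) + 0#
      ≈⟨ trans (+-identityʳ _) (*-identityˡ _) ⟩
    f 0 0 * detℕ n (λ r s → f (suc r) (suc s))
      ∎

  det-firstCol-unit : ∀ n {f} → (∀ i → i < n → f i 0 ≈ 0#) →
    detℕ (suc n) f ≈ negOnePow R n * (f n 0 * detℕ n (λ r s → f r (suc s)))
  det-firstCol-unit zero    {f} _ = trans (det₁ f) (sym (trans (*-identityˡ _) (*-identityʳ _)))
  det-firstCol-unit (suc m) {f} below = begin
    detℕ (suc (suc m)) f
      ≈⟨ laplace (suc m) f ⟩
    laplaceTerm (suc m) f 0 + sumℕ R (suc m) (λ j → laplaceTerm (suc m) f (suc j))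
      ≈⟨ +-cong (term-zero-entry _ _ (below 0 z<s)) (sumℕ-cong (suc m) shifted) ⟩
    0# + sumℕ R (suc m) (λ j → κ * laplaceTerm m f′ j)
      ≈⟨ trans (+-identityˡ _) (sumℕ-*ˡ (suc m) κ (laplaceTerm m f′)) ⟩
    κ * sumℕ R (suc m) (laplaceTerm m f′)
      ≈⟨ *-congˡ (laplace m f′) ⟨
    κ * detℕ (suc m) f′
      ≈⟨ *-assoc _ _ _ ⟩
    negOnePow R (suc m) * (f (suc m) 0 * detℕ (suc m) f′)
      ∎
    where
    f′ : Matrix
    f′ r s = f r (suc s)
    κ : Carrier
    κ = negOnePow R (suc m) * f (suc m) 0
    shifted : ∀ j → j < suc m → laplaceTerm (suc m) f (suc j) ≈ κ * laplaceTerm m f′ j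
    shifted j _ = trans
      (*-congˡ (*-congˡ (det-firstCol-unit m {minor (suc j) f} (λ i i<m → below (suc i) (s<s i<m)))))
      (solve 5 (λ s a t e d → (:- s) :* (a :* (t :* (e :* d))) := ((:- t) :* e) :* (s :* (a :* d)))
         refl (negOnePow R j) (f 0 (suc j)) (negOnePow R m) (f (suc m) 0) (detℕ m (minor j f′)))

  negOnePow-square : ∀ n → negOnePow R n * negOnePow R n ≈ 1#
  negOnePow-square zero    = *-identityˡ 1#
  negOnePow-square (suc n) =
    trans (solve 1 (λ s → (:- s) :* (:- s) := s :* s) refl (negOnePow R n)) (negOnePow-square n)

module SecondOrderRecurrence {c ℓ : Level} (R : CommutativeRing c ℓ) where
  open CommutativeRing R
  open import Data.Product.Base using (_×_; _,_; proj₁)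

  Satisfies : Carrier → Carrier → (ℕ → Carrier) → Set ℓ
  Satisfies α β u = ∀ q → u (suc (suc q)) ≈ α * u (suc q) + β * u q

  recurrence-unique : ∀ {α β u v} → Satisfies α β u → Satisfies α β v →
    u 0 ≈ v 0 → u 1 ≈ v 1 → ∀ q → u q ≈ v q
  recurrence-unique {u = u} {v} u-rec v-rec u₀ u₁ q = proj₁ (consecutive q)
    where
    consecutive : ∀ q → u q ≈ v q × u (suc q) ≈ v (suc q)
    consecutive zero    = u₀ , u₁
    consecutive (suc q) with consecutive q
    ... | uq≈vq , uq+1≈vq+1 =
      uq+1≈vq+1 , trans (u-rec q) (trans (+-cong (*-congˡ uq+1≈vq+1) (*-congˡ uq≈vq)) (sym (v-rec q)))

module AntidiagonalMatrix {c ℓ : Level} (R : CommutativeRing c ℓ) (b : CommutativeRing.Carrier R) where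
  open CommutativeRing R hiding (zero)
  open SetoidReasoning setoid
  open IntegerCoefficients R
  open Sums R
  open Determinant R
  open Algebra.Properties.Ring ring using (-1*x≈-x)

  δ : ℕ → ℕ → Carrier
  δ zero    zero    = 1#
  δ zero    (suc j) = 0#
  δ (suc i) zero    = 0#
  δ (suc i) (suc j) = δ i j

  δ-refl : ∀ i → δ i i ≡ 1#
  δ-refl zero    = ≡.refl
  δ-refl (suc i) = δ-refl i

  δ-≢ : ∀ {i j} → i ≢ j → δ i j ≡ 0#
  δ-≢ {zero}  {zero}  i≢j = ⊥-elim (i≢j ≡.refl)
  δ-≢ {zero}  {suc j} _   = ≡.refl
  δ-≢ {suc i} {zero}  _   = ≡.refl
  δ-≢ {suc i} {suc j} i≢j = δ-≢ (i≢j ∘ cong suc)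

  δ-< : ∀ {i j} → i < j → δ i j ≡ 0#
  δ-< i<j = δ-≢ (ℕ.<⇒≢ i<j)

  δ-> : ∀ {i j} → j < i → δ i j ≡ 0#
  δ-> j<i = δ-≢ (ℕ.>⇒≢ j<i)

  +-δ-≢ : ∀ x y {i j} → i ≢ j → x + δ i j * y ≈ x
  +-δ-≢ x y i≢j = trans (+-congˡ (trans (*-congʳ (reflexive (δ-≢ i≢j))) (zeroˡ y))) (+-identityʳ x)

  +-δ-refl : ∀ i x y → x + δ i i * y ≈ x + y
  +-δ-refl i x y = +-congˡ (trans (*-congʳ (reflexive (δ-refl i))) (*-identityˡ y))

  bFrom : ℕ → ℕ → Carrier
  bFrom zero    n       = b
  bFrom (suc k) zero    = 0#
  bFrom (suc k) (suc n) = bFrom k n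

  bFrom-≥ : ∀ {k n} → k ≤ n → bFrom k n ≡ b
  bFrom-≥ {zero}          _         = ≡.refl
  bFrom-≥ {suc k} {suc n} (s≤s k≤n) = bFrom-≥ k≤n

  bFrom-< : ∀ {k n} → n < k → bFrom k n ≡ 0#
  bFrom-< {suc k} {zero}  _         = ≡.refl
  bFrom-< {suc k} {suc n} (s<s n<k) = bFrom-< n<k

  -- At size k, a k is the matrix A of the statement with indices shifted to start at 0.
  a : ℕ → Matrix
  a k i j = δ i j + - bFrom k (suc (i ℕ.+ j))

  a-shift : ∀ k i j → a (suc (suc k)) (suc i) (suc j) ≈ a k i j
  a-shift k i j = reflexive (cong (λ n → δ i j + - bFrom k n) (ℕ.+-suc i j))

  a-far : ∀ {k} i j → k ≤ suc (i ℕ.+ j) → a k i j ≈ δ i j + - b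
  a-far i j k≤ = reflexive (cong (λ x → δ i j + - x) (bFrom-≥ k≤))

  a-near : ∀ {k} i j → suc (i ℕ.+ j) < k → a k i j ≈ δ i j
  a-near i j <k = trans (reflexive (cong (λ x → δ i j + - x) (bFrom-< <k)))
    (solve 1 (λ d → d :+ (:- :0) := d) refl (δ i j))

  bFrom-when-< : ∀ {k x y} → k < suc x ℕ.+ suc y → bFrom k (suc (x ℕ.+ y)) ≡ b
  bFrom-when-< {k} {x} {y} k< = bFrom-≥ (≡.subst (k ≤_) (ℕ.+-suc x y) (ℕ.≤-pred k<))

  bFrom-when-≮ : ∀ {k x y} → ¬ k < suc x ℕ.+ suc y → bFrom k (suc (x ℕ.+ y)) ≡ 0#
  bFrom-when-≮ {k} {x} {y} k≮ = bFrom-< (≡.subst (λ z → suc z ≤ k) (ℕ.+-suc x y) (ℕ.≮⇒≥ k≮))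

  entry-≡ : ∀ {d d′ e e′} → d ≡ d′ → e ≡ e′ → d + - e ≈ d′ + - e′
  entry-≡ d≡d′ e≡e′ = reflexive (cong₂ (λ x y → x + - y) d≡d′ e≡e′)

  matA≈a : ∀ k (i j : Fin k) → matA R k b i j ≈ a k (toℕ i) (toℕ j)
  matA≈a k i j with i Fin.≟ j | k ℕ.<? suc (toℕ i) ℕ.+ suc (toℕ j)
  ... | yes ≡.refl | yes k< = entry-≡ (≡.sym (δ-refl (toℕ i))) (≡.sym (bFrom-when-< k<))
  ... | yes ≡.refl | no  k≮ = entry-≡ (≡.sym (δ-refl (toℕ i))) (≡.sym (bFrom-when-≮ k≮))
  ... | no  i≢j    | yes k< = entry-≡ (≡.sym (δ-≢ (i≢j ∘ Fin.toℕ-injective))) (≡.sym (bFrom-when-< k<))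
  ... | no  i≢j    | no  k≮ = entry-≡ (≡.sym (δ-≢ (i≢j ∘ Fin.toℕ-injective))) (≡.sym (bFrom-when-≮ k≮))

  D : ℕ → Carrier
  D k = detℕ k (a k)

  D⁺ : ℕ → Carrier
  D⁺ k = detℕ (suc k) (a k)

  det-matA : ∀ k → det R k (matA R k b) ≈ D k
  det-matA k = det-cong k (matA≈a k)

  -- The first row of a (m + 2) is e₀ - b e₍ₘ₊₁₎; the minor of its entry -b has first column
  -- -b eₘ, and expanding that minor along its first column leaves the m × m block of a m.
  D-expand : ∀ m → D (suc (suc m)) ≈ D⁺ m + - (b * (b * D m))
  D-expand m = begin
    D (suc (suc m))
      ≈⟨ laplace (suc m) A ⟩
    t 0 + sumℕ R (suc m) (λ j → t (suc j))
      ≈⟨ +-congˡ (sumℕ-last m (λ j → t (suc j))) ⟩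
    t 0 + (sumℕ R m (λ j → t (suc j)) + t (suc m))
      ≈⟨ +-cong first (+-cong (sumℕ-zero m middle) last) ⟩
    D⁺ m + (0# + - (b * (b * D m)))
      ≈⟨ +-congˡ (+-identityˡ _) ⟩
    D⁺ m + - (b * (b * D m))
      ∎
    where
    A = a (suc (suc m))
    t = laplaceTerm (suc m) A
    s = negOnePow R m

    first : t 0 ≈ D⁺ m
    first = begin
      1# * (A 0 0 * detℕ (suc m) (minor 0 A))
        ≈⟨ trans (*-identityˡ _) (*-congʳ (a-near {suc (suc m)} 0 0 (s<s z<s))) ⟩
      1# * detℕ (suc m) (minor 0 A)
        ≈⟨ trans (*-identityˡ _) (detℕ-cong (suc m) (λ r s _ _ → a-shift m r s)) ⟩
      D⁺ m
        ∎

    middle : ∀ j → j < m → t (suc j) ≈ 0#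
    middle j j<m = term-zero-entry _ _ (a-near 0 (suc j) (s<s (s<s j<m)))

    G : Matrix
    G = minor (suc m) A

    G-col₀ : ∀ i → i < m → G i 0 ≈ 0#
    G-col₀ i i<m = a-near (suc i) 0 (s<s (s<s (≡.subst (_< m) (≡.sym (ℕ.+-identityʳ i)) i<m)))

    G-corner : G m 0 ≈ - b
    G-corner = trans (a-far (suc m) 0 (s≤s (s≤s (ℕ.m≤m+n m 0)))) (+-identityˡ _)

    G-shift : Agree m m (λ r s → G r (suc s)) (a m)
    G-shift r s _ s<m = trans (a-shift m r (punchInℕ m s)) (reflexive (cong (a m r) (punchInℕ-< s<m)))

    det-G : detℕ (suc m) G ≈ s * (- b * D m)
    det-G = trans (det-firstCol-unit m {G} G-col₀) (*-congˡ (*-cong G-corner (detℕ-cong m G-shift)))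

    last : t (suc m) ≈ - (b * (b * D m))
    last = begin
      - s * (A 0 (suc m) * detℕ (suc m) G)
        ≈⟨ *-congˡ (*-cong (trans (a-far 0 (suc m) ℕ.≤-refl) (+-identityˡ _)) det-G) ⟩
      - s * (- b * (s * (- b * D m)))
        ≈⟨ solve 3 (λ s b d → (:- s) :* ((:- b) :* (s :* ((:- b) :* d)))
                             := (s :* s) :* (:- (b :* (b :* d)))) refl s b (D m) ⟩
      (s * s) * - (b * (b * D m))
        ≈⟨ trans (*-congʳ (negOnePow-square m)) (*-identityˡ _) ⟩
      - (b * (b * D m))
        ∎

  -- Subtracting column n from column n + 1 and then adding row n + 1 to row n turns the last
  -- column of a (n + 1) into e₍ₙ₊₁₎; row n of the remaining block is then 2 (row n) - eₙ.
  module D⁺-Reduction (p : ℕ) where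
    n : ℕ
    n = suc p

    M H₁ H₂ Q : Matrix
    M       = a (suc n)
    H₁ i j  = M i j + δ j (suc n) * - M i n
    H₂ i j  = H₁ i j + δ i n * H₁ (suc n) j
    Q i j   = M i j + δ i n * (δ i j + - M i j)

    H₁≈M : Agree (suc (suc n)) (suc n) H₁ M
    H₁≈M i j _ j<1+n = +-δ-≢ _ _ (ℕ.<⇒≢ j<1+n)

    H₁-lastCol : ∀ i → i < suc (suc n) → H₁ i (suc n) ≈ M i (suc n) + - 1# * M i n
    H₁-lastCol i _ = trans (+-δ-refl (suc n) _ _) (+-congˡ (sym (-1*x≈-x _)))

    H₁-last : ∀ i → H₁ i (suc n) ≈ δ i (suc n) + - δ i n
    H₁-last i = begin
      H₁ i (suc n)
        ≈⟨ +-δ-refl (suc n) _ _ ⟩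
      M i (suc n) + - M i n
        ≈⟨ +-cong (a-far i (suc n) (s≤s (ℕ.≤-trans (ℕ.n≤1+n n) (ℕ.m≤n+m (suc n) i))))
                  (-‿cong (a-far i n (s≤s (ℕ.m≤n+m n i)))) ⟩
      (δ i (suc n) + - b) + - (δ i n + - b)
        ≈⟨ solve 3 (λ d e b → (d :+ (:- b)) :+ (:- (e :+ (:- b))) := d :+ (:- e)) refl _ _ b ⟩
      δ i (suc n) + - δ i n
        ∎

    H₂≈H₁ : Agree n (suc (suc n)) H₂ H₁
    H₂≈H₁ i j i<n _ = +-δ-≢ _ _ (ℕ.<⇒≢ i<n)

    H₂-rowₙ : ∀ j → j < suc (suc n) → H₂ n j ≈ H₁ n j + 1# * H₁ (suc n) j
    H₂-rowₙ j _ = trans (+-δ-refl n _ _) (+-congˡ (sym (*-identityˡ _)))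

    H₂-rowₙ₊₁ : ∀ j → j < suc (suc n) → H₂ (suc n) j ≈ H₁ (suc n) j
    H₂-rowₙ₊₁ j _ = +-δ-≢ _ _ (ℕ.>⇒≢ (ℕ.n<1+n n))

    H₂-above : ∀ i → i < suc n → H₂ i (suc n) ≈ 0#
    H₂-above i i<1+n with ℕ.m<1+n⇒m<n∨m≡n i<1+n
    ... | inj₁ i<n = begin
      H₂ i (suc n)             ≈⟨ trans (H₂≈H₁ i (suc n) i<n (ℕ.n<1+n (suc n))) (H₁-last i) ⟩
      δ i (suc n) + - δ i n    ≡⟨ cong₂ (λ x y → x + - y) (δ-< (ℕ.m<n⇒m<1+n i<n)) (δ-< i<n) ⟩
      0# + - 0#                ≈⟨ solve 0 (:0 :+ (:- :0) := :0) refl ⟩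
      0#                       ∎
    ... | inj₂ ≡.refl = begin
      H₂ n (suc n)
        ≈⟨ trans (H₂-rowₙ (suc n) (ℕ.n<1+n (suc n))) (+-cong (H₁-last n) (*-congˡ (H₁-last (suc n)))) ⟩
      (δ n (suc n) + - δ n n) + 1# * (δ n n + - δ (suc n) n)
        ≡⟨ cong₂ (λ x y → (x + - y) + 1# * (y + - δ (suc n) n)) (δ-< (ℕ.n<1+n n)) (δ-refl n) ⟩
      (0# + - 1#) + 1# * (1# + - δ (suc n) n)
        ≡⟨ cong (λ x → (0# + - 1#) + 1# * (1# + - x)) (δ-> (ℕ.n<1+n n)) ⟩
      (0# + - 1#) + 1# * (1# + - 0#)
        ≈⟨ solve 0 ((:0 :+ (:- :1)) :+ :1 :* (:1 :+ (:- :0))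
                    := :0) refl ⟩
      0#
        ∎

    H₂-corner : H₂ (suc n) (suc n) ≈ 1#
    H₂-corner = begin
      H₂ (suc n) (suc n)      ≈⟨ trans (H₂-rowₙ₊₁ (suc n) (ℕ.n<1+n (suc n))) (H₁-last (suc n)) ⟩
      δ n n + - δ (suc n) n   ≡⟨ cong₂ (λ x y → x + - y) (δ-refl n) (δ-> (ℕ.n<1+n n)) ⟩
      1# + - 0#               ≈⟨ solve 0 (:1 :+ (:- :0) := :1) refl ⟩
      1#                      ∎

    H₂≈M : Agree n (suc n) H₂ M
    H₂≈M i j i<n j<1+n =
      trans (H₂≈H₁ i j i<n (ℕ.m<n⇒m<1+n j<1+n)) (H₁≈M i j (ℕ.m<n⇒m<1+n (ℕ.m<n⇒m<1+n i<n)) j<1+n)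

    Q≈M : Agree n (suc n) Q M
    Q≈M i j i<n _ = +-δ-≢ _ _ (ℕ.<⇒≢ i<n)

    Q-rowₙ : ∀ j → Q n j ≈ δ n j
    Q-rowₙ j = trans (+-δ-refl n _ _) (solve 2 (λ x d → x :+ (d :+ (:- x)) := d) refl (M n j) (δ n j))

    H₂-rowₙ-split : ∀ j → j < suc n → H₂ n j ≈ (1# + 1#) * M n j + - 1# * Q n j
    H₂-rowₙ-split j j<1+n = begin
      H₂ n j
        ≈⟨ trans (H₂-rowₙ j (ℕ.m<n⇒m<1+n j<1+n))
             (+-cong (H₁≈M n j (ℕ.m<n⇒m<1+n (ℕ.n<1+n n)) j<1+n)
                     (*-congˡ (H₁≈M (suc n) j (ℕ.n<1+n (suc n)) j<1+n))) ⟩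
      M n j + 1# * M (suc n) j
        ≈⟨ +-cong (a-far n j (s≤s (ℕ.m≤m+n n j)))
                  (*-congˡ (trans (a-far (suc n) j (s≤s (ℕ.≤-trans (ℕ.n≤1+n n) (ℕ.m≤m+n (suc n) j))))
                                  (+-congʳ (reflexive (δ-> j<1+n))))) ⟩
      (δ n j + - b) + 1# * (0# + - b)
        ≈⟨ solve 2 (λ d b → (d :+ (:- b)) :+ :1 :* (:0 :+ (:- b))
                         := (:1 :+ :1) :* (d :+ (:- b)) :+ (:- :1) :* d) refl _ b ⟩
      (1# + 1#) * (δ n j + - b) + - 1# * δ n j
        ≈⟨ +-cong (*-congˡ (sym (a-far n j (s≤s (ℕ.m≤m+n n j))))) (*-congˡ (sym (Q-rowₙ j))) ⟩
      (1# + 1#) * M n j + - 1# * Q n j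
        ∎

    det-Q : detℕ (suc n) Q ≈ D p
    det-Q = begin
      detℕ (suc n) Q
        ≈⟨ det-lastRow-unit n {Q} (λ j j<n → trans (Q-rowₙ j) (reflexive (δ-> j<n)))
                                  (trans (Q-rowₙ n) (reflexive (δ-refl n))) ⟩
      1# * detℕ n Q
        ≈⟨ trans (*-identityˡ _) (detℕ-cong n (λ i j i<n j<n → Q≈M i j i<n (ℕ.m<n⇒m<1+n j<n))) ⟩
      detℕ n M
        ≈⟨ det-firstRow-unit p {M} (λ j j<p → a-near 0 (suc j) (s<s (s<s j<p))) ⟩
      M 0 0 * detℕ p (λ r s → M (suc r) (suc s))
        ≈⟨ *-cong (a-near {suc n} 0 0 (s<s z<s)) (detℕ-cong p (λ r s _ _ → a-shift p r s)) ⟩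
      1# * D p
        ≈⟨ *-identityˡ _ ⟩
      D p
        ∎

    D⁺-reduce : D⁺ (suc n) ≈ (1# + 1#) * D (suc n) + - D p
    D⁺-reduce = begin
      detℕ (suc (suc n)) M
        ≈⟨ det-addLastCol n {M} {H₁} H₁≈M H₁-lastCol ⟨
      detℕ (suc (suc n)) H₁
        ≈⟨ det-addRow n {H₁} {H₂} H₂≈H₁ H₂-rowₙ H₂-rowₙ₊₁ ⟨
      detℕ (suc (suc n)) H₂
        ≈⟨ det-lastCol-unit (suc n) {H₂} H₂-above H₂-corner ⟩
      1# * detℕ (suc n) H₂
        ≈⟨ trans (*-identityˡ _) (det-linear-lastRow n {M} {Q} {H₂} H₂≈M Q≈M H₂-rowₙ-split) ⟩
      (1# + 1#) * D (suc n) + - 1# * detℕ (suc n) Q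
        ≈⟨ +-congˡ (trans (-1*x≈-x _) (-‿cong det-Q)) ⟩
      (1# + 1#) * D (suc n) + - D p
        ∎

  open D⁺-Reduction using (D⁺-reduce)

  D-recurrence : ∀ p →
    D (suc (suc (suc (suc p)))) ≈ ((1# + 1#) + - (b * b)) * D (suc (suc p)) + - 1# * D p
  D-recurrence p = begin
    D (suc (suc (suc (suc p))))
      ≈⟨ D-expand (suc (suc p)) ⟩
    D⁺ (suc (suc p)) + - (b * (b * D (suc (suc p))))
      ≈⟨ +-congʳ (D⁺-reduce p) ⟩
    ((1# + 1#) * D (suc (suc p)) + - D p) + - (b * (b * D (suc (suc p))))
      ≈⟨ solve 3 (λ b x y → ((:1 :+ :1) :* x :+ (:- y)) :+ (:- (b :* (b :* x)))
                         := ((:1 :+ :1) :+ (:- (b :* b))) :* x :+ (:- :1) :* y)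
           refl b _ _ ⟩
    ((1# + 1#) + - (b * b)) * D (suc (suc p)) + - 1# * D p
      ∎

  D-2 : D 2 ≈ (1# + - b) + - (b * (b * 1#))
  D-2 = trans (D-expand 0) (+-congʳ (det₁ (a 0)))

module BinomialSums {c ℓ : Level} (R : CommutativeRing c ℓ) (b : CommutativeRing.Carrier R) where
  open CommutativeRing R hiding (zero)
  open SetoidReasoning setoid
  open Algebra.Properties.Ring ring using (-1*x≈-x)
  open IntegerCoefficients R
  open Sums R

  natR-+ : ∀ m n → natR R (m ℕ.+ n) ≈ natR R m + natR R n
  natR-+ zero    n = sym (+-identityˡ _)
  natR-+ (suc m) n = trans (+-congˡ (natR-+ m n)) (sym (+-assoc _ _ _))

  binomialTerm : (ℕ → Carrier) → ℕ → ℕ → Carrier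
  binomialTerm σ k i = σ i * (natR R ((⌊ k ∸ i /2⌋ ℕ.+ i) C i) * pow R b i)

  binomialSum : (ℕ → Carrier) → ℕ → Carrier
  binomialSum σ k = sumℕ R (suc k) (binomialTerm σ k)

  -- Pascal's rule C(N + 1, j + 1) = C(N, j) + C(N, j + 1) splits each term of the sum for k + 2
  -- into κ b times a term of the sum for k + 1 and a term of the sum for k; the last two terms
  -- have coefficient 1 and go to the former only.
  module Pascal {τ ρ : ℕ → Carrier} {κ : Carrier} (τ-shift : ∀ i → τ (suc i) ≈ κ * ρ i) (k : ℕ) where

    binomialTerm-inner : ∀ j → j < k → binomialTerm τ (suc (suc k)) (suc j)
      ≈ κ * (b * binomialTerm ρ (suc k) j) + binomialTerm τ k (suc j)
    binomialTerm-inner j j<k = begin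
      τ (suc j) * (natR R ((⌊ suc k ∸ j /2⌋ ℕ.+ suc j) C suc j) * (b * pow R b j))
        ≡⟨ cong (λ m → τ (suc j) * (natR R m * (b * pow R b j))) τ-coeff ⟩
      τ (suc j) * (natR R (N C j ℕ.+ N C suc j) * (b * pow R b j))
        ≈⟨ *-cong (τ-shift j) (*-congʳ (natR-+ (N C j) (N C suc j))) ⟩
      (κ * ρ j) * ((natR R (N C j) + natR R (N C suc j)) * (b * pow R b j))
        ≈⟨ solve 6 (λ κ r u v b P → (κ :* r) :* ((u :+ v) :* (b :* P))
                                 := κ :* (b :* (r :* (u :* P))) :+ (κ :* r) :* (v :* (b :* P)))
             refl κ (ρ j) _ _ b _ ⟩
      κ * (b * (ρ j * (natR R (N C j) * pow R b j)))
        + (κ * ρ j) * (natR R (N C suc j) * (b * pow R b j))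
        ≈⟨ +-cong (*-congˡ (*-congˡ (*-congˡ (*-congʳ ρ-coeff)))) (*-congʳ (τ-shift j)) ⟨
      κ * (b * binomialTerm ρ (suc k) j) + binomialTerm τ k (suc j)
        ∎
      where
      h = ⌊ k ∸ suc j /2⌋
      N = h ℕ.+ suc j
      half : ⌊ suc k ∸ j /2⌋ ≡ suc h
      half = cong ⌊_/2⌋ (≡.trans (ℕ.+-∸-assoc 1 (ℕ.<⇒≤ j<k)) (cong suc (ℕ.+-∸-assoc 1 j<k)))
      τ-coeff : (⌊ suc k ∸ j /2⌋ ℕ.+ suc j) C suc j ≡ N C j ℕ.+ N C suc j
      τ-coeff = ≡.trans (cong (λ m → (m ℕ.+ suc j) C suc j) half) (≡.sym (nCk+nC[k+1]≡[n+1]C[k+1] N j))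
      ρ-coeff : natR R ((⌊ suc k ∸ j /2⌋ ℕ.+ j) C j) ≈ natR R (N C j)
      ρ-coeff = reflexive (cong (λ m → natR R (m C j)) (≡.trans (cong (ℕ._+ j) half) (≡.sym (ℕ.+-suc h j))))

    binomialTerm-edge : ∀ j → ⌊ suc k ∸ j /2⌋ ≡ 0 →
      binomialTerm τ (suc (suc k)) (suc j) ≈ κ * (b * binomialTerm ρ (suc k) j)
    binomialTerm-edge j half≡0 = begin
      τ (suc j) * (natR R ((⌊ suc k ∸ j /2⌋ ℕ.+ suc j) C suc j) * (b * pow R b j))
        ≡⟨ cong (λ m → τ (suc j) * (natR R m * (b * pow R b j)))
                (≡.trans (diagonal (suc j)) (≡.sym (diagonal j))) ⟩
      τ (suc j) * (natR R ((⌊ suc k ∸ j /2⌋ ℕ.+ j) C j) * (b * pow R b j))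
        ≈⟨ *-congʳ (τ-shift j) ⟩
      (κ * ρ j) * (natR R ((⌊ suc k ∸ j /2⌋ ℕ.+ j) C j) * (b * pow R b j))
        ≈⟨ solve 5 (λ κ r u b P → (κ :* r) :* (u :* (b :* P)) := κ :* (b :* (r :* (u :* P))))
             refl κ (ρ j) _ b _ ⟩
      κ * (b * binomialTerm ρ (suc k) j)
        ∎
      where
      diagonal : ∀ i → (⌊ suc k ∸ j /2⌋ ℕ.+ i) C i ≡ 1
      diagonal i = ≡.trans (cong (λ m → (m ℕ.+ i) C i) half≡0) (nCn≡1 i)

    binomialSum-step : binomialSum τ (suc (suc k)) ≈ binomialSum τ k + κ * (b * binomialSum ρ (suc k))
    binomialSum-step = begin
      t₀ + sumℕ R (suc (suc k)) F
        ≈⟨ +-congˡ (sumℕ-last₂ k F) ⟩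
      t₀ + ((sumℕ R k F + F k) + F (suc k))
        ≈⟨ +-congˡ (+-cong (+-cong (sumℕ-cong k {F} {λ j → κ * (b * P j) + G j} binomialTerm-inner)
                                    (binomialTerm-edge k (cong ⌊_/2⌋ (ℕ.m+n∸n≡m 1 k))))
                           (binomialTerm-edge (suc k) (cong ⌊_/2⌋ (ℕ.n∸n≡0 (suc k))))) ⟩
      t₀ + ((sumℕ R k (λ j → κ * (b * P j) + G j) + κ * (b * P k)) + κ * (b * P (suc k)))
        ≈⟨ +-congˡ (+-congʳ (+-congʳ (trans (sumℕ-+ k (λ j → κ * (b * P j)) G)
             (+-congʳ (trans (sumℕ-*ˡ k κ (λ j → b * P j)) (*-congˡ (sumℕ-*ˡ k b P))))))) ⟩
      t₀ + (((κ * (b * sumℕ R k P) + sumℕ R k G) + κ * (b * P k)) + κ * (b * P (suc k)))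
        ≈⟨ solve 7 (λ t x y u v κ b → t :+ (((κ :* (b :* x) :+ y) :+ κ :* (b :* u)) :+ κ :* (b :* v))
                                   := (t :+ y) :+ κ :* (b :* ((x :+ u) :+ v)))
             refl t₀ _ _ _ _ κ b ⟩
      (t₀ + sumℕ R k G) + κ * (b * ((sumℕ R k P + P k) + P (suc k)))
        ≈⟨ +-congˡ (*-congˡ (*-congˡ (sumℕ-last₂ k P))) ⟨
      binomialSum τ k + κ * (b * binomialSum ρ (suc k))
        ∎
      where
      t₀ = binomialTerm τ k 0
      F = λ j → binomialTerm τ (suc (suc k)) (suc j)
      G = λ j → binomialTerm τ k (suc j)
      P = binomialTerm ρ (suc k)

  open Pascal using (binomialSum-step)

  σ₁ σ₂ : ℕ → Carrier
  σ₁ i = negOnePow R ⌊ i ℕ.+ 1 /2⌋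
  σ₂ i = negOnePow R ⌊ i /2⌋

  S : ℕ → Carrier
  S = binomialSum σ₁

  σ₁-shift : ∀ i → σ₁ (suc i) ≈ - 1# * σ₂ i
  σ₁-shift i = trans (reflexive (cong (λ m → negOnePow R ⌊ suc m /2⌋) (ℕ.+-comm i 1))) (sym (-1*x≈-x _))

  σ₂-shift : ∀ i → σ₂ (suc i) ≈ 1# * σ₁ i
  σ₂-shift i = trans (reflexive (cong (λ m → negOnePow R ⌊ m /2⌋) (ℕ.+-comm 1 i))) (sym (*-identityˡ _))

  S-recurrence : ∀ p →
    S (suc (suc (suc (suc p)))) ≈ ((1# + 1#) + - (b * b)) * S (suc (suc p)) + - 1# * S p
  S-recurrence p = begin
    S (suc (suc (suc (suc p))))
      ≈⟨ binomialSum-step {σ₁} {σ₂} σ₁-shift (suc (suc p)) ⟩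
    X + - 1# * (b * binomialSum σ₂ (suc (suc (suc p))))
      ≈⟨ +-congˡ (*-congˡ (*-congˡ (binomialSum-step {σ₂} {σ₁} σ₂-shift (suc p)))) ⟩
    X + - 1# * (b * (Y + 1# * (b * X)))
      ≈⟨ solve 3 (λ x y b → x :+ (:- :1) :* (b :* (y :+ :1 :* (b :* x)))
                         := ((:1 :+ :1) :+ (:- (b :* b))) :* x :+ (:- :1) :* (x :+ b :* y))
           refl X Y b ⟩
    ((1# + 1#) + - (b * b)) * X + - 1# * (X + b * Y)
      ≈⟨ +-congˡ (*-congˡ X+bY≈Z) ⟩
    ((1# + 1#) + - (b * b)) * X + - 1# * S p
      ∎
    where
    X = S (suc (suc p))
    Y = binomialSum σ₂ (suc p)
    X+bY≈Z : X + b * Y ≈ S p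
    X+bY≈Z = trans (+-congʳ (binomialSum-step {σ₁} {σ₂} σ₁-shift p))
      (solve 2 (λ z w → (z :+ (:- :1) :* w) :+ w := z) refl (S p) (b * Y))

  S-0 : S 0 ≈ 1#
  S-0 = solve 0 (:1 :* ((:1 :+ :0) :* :1) :+ :0 := :1) refl

  S-2 : S 2 ≈ (1# + - b) + - (b * (b * 1#))
  S-2 = solve 1 (λ b →
      :1 :* ((:1 :+ :0) :* :1)
        :+ ((:- :1) :* ((:1 :+ :0) :* (b :* :1))
        :+ ((:- :1) :* ((:1 :+ :0) :* (b :* (b :* :1))) :+ :0))
      := (:1 :+ (:- b)) :+ (:- (b :* (b :* :1)))) refl b

open import Data.Nat using (_+_)
open import Data.Nat.Divisibility using (_∣_; divides)

lemma2 : (k : ℕ) → 2 ≤ k → 2 ∣ k →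
    {c ℓ : Level} (R : CommutativeRing c ℓ) (b : CommutativeRing.Carrier R) →
    CommutativeRing._≈_ R (det R k (matA R k b))
      (sumℕ R (suc k) (λ i → CommutativeRing._*_ R (negOnePow R ⌊ i + 1 /2⌋)
        (CommutativeRing._*_ R (natR R ((⌊ k ∸ i /2⌋ + i) C i)) (pow R b i))))
lemma2 k _ (divides q k≡q*2) R b = begin
  det R k (matA R k b)   ≈⟨ det-matA k ⟩
  D k                    ≡⟨ cong D k≡q*2 ⟩
  D (q ℕ.* 2)            ≈⟨ recurrence-unique {u = D ∘ (ℕ._* 2)} {v = S ∘ (ℕ._* 2)}
                              (D-recurrence ∘ (ℕ._* 2)) (S-recurrence ∘ (ℕ._* 2))
                              (sym S-0) (trans D-2 (sym S-2)) q ⟩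
  S (q ℕ.* 2)            ≡⟨ cong S k≡q*2 ⟨
  S k                    ∎
  where
  open CommutativeRing R using (setoid; sym; trans)
  open SetoidReasoning setoid
  open AntidiagonalMatrix R b
  open BinomialSums R b
  open SecondOrderRecurrence R
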